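{- Let $C\subseteq\mathrm{Pmf}$ and $D\subseteq\mathrm{Wgt}$ satisfy $C=\mathrm{Pol}(D)$ and $D=\mathrm{Inv}(C)$. Say that a pmf $f\colon B^n\rightrightarrows B^m$ has the right shape if $n>0$ (resp. $m>0$; both $n>0$ and $m>0$). (1) The following are equivalent: $C$ is the pmf clone generated by some set of pmf of the right shape; every $f\in C$ is of the right shape except possibly $\mathrm{id}_0$ and the empty pmf $\emptyset\colon B^0\rightrightarrows B^0$; $D$ contains the constant weight $\mathrm{cst}_0\colon B^0\to(\{0,1\},1,\land)$ with value $0$, where $\{0,1\}$ is ordered by $\le$ (resp. $\ge$; $=$). (2) The following are equivalent: $D$ is the weight coclone generated by some class of weights $w\colon B^k\to\mathbf M$ with $k>0$; every nontrivial weight $w\colon B^k\to\mathbf M$ in $D$ has $k>0$; $C$ contains the empty pmf $\emptyset\colon B^0\rightrightarrows B^1$ and $\emptyset\colon B^1\rightrightarrows B^0$ (and hence the empty pmf $\emptyset\colon B^n\rightrightarrows B^m$ for all $n,m$).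
   Context: Fix a set $B$. Natural numbers start at $0$ and $k\in\mathbb N$ is identified with $\{0,\dots,k-1\}$. For $n,m\in\mathbb N$, a partial multi-valued function (pmf) $f\colon B^n\rightrightarrows B^m$ is a relation $f\subseteq B^n\times B^m$; write $f(x)\approx y$ for $(x,y)\in f$. $\mathrm{Pmf}$ is the set of all pmf. A pomonoid $(M,1,\cdot,\le)$ is a monoid with a partial order such that $x\le y$ implies $xz\le yz$ and $zx\le zy$. A $k$-ary weight is a map $w\colon B^k\to\mathbf M$ into some pomonoid; $\mathrm{Wgt}$ is the class of all weights; a weight is trivial if it is constant with value the unit $1$. For $a=(a_i^j)_{i<n}^{j<k}\in B^{k\times n}$, rows are $a^j=(a^j_i:i<n)$, columns $a_i=(a_i^j:j<k)$. A pmf $f\colon B^n\rightrightarrows B^m$ preserves $w\colon B^k\to\mathbf M$ if for all $a\in B^{k\times n}$, $b\in B^{k\times m}$ with $f(a^j)\approx b^j$ for all $j<k$, we have $\prod_{i<n}w(a_i)\le\prod_{i<m}w(b_i)$ (empty product $=1$). $\mathrm{Inv}(C)$ is the class of weights preserved by all $f\in C$; $\mathrm{Pol}(D)$ the set of pmf preserving all $w\in D$. A pmf clone is a set $C\subseteq\mathrm{Pmf}$ such that: (I) for each $n,m$, a pmf $f\colon B^n\rightrightarrows B^m$ lies in $C$ iff every finite subset of $f$ lies in $C$; (II) $\mathrm{id}_n\in C$ for all $n$; (III) $C$ is closed under composition, $(g\circ f)(x)\approx z$ iff $f(x)\approx y$ and $g(y)\approx z$ for some $y$; (IV) $C$ is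 closed under $f\times g$, where $(f\times g)(x,x')\approx(y,y')$ iff $f(x)\approx y$ and $g(x')\approx y'$. A weight coclone is a class $D$ of weights closed under: (A) $w\mapsto w\circ\tilde\rho\colon B^{k'}\to\mathbf M$ for $w\colon B^k\to\mathbf M$ and any map $\rho\colon k\to k'$, where $\tilde\rho(x^0,\dots,x^{k'-1})=(x^{\rho(0)},\dots,x^{\rho(k-1)})$; (B) $w\mapsto\varphi\circ w$ for any monotone monoid homomorphism $\varphi\colon\mathbf M\to\mathbf M'$ into a pomonoid; (C) forming $w\colon B^k\to\prod_{\alpha\in I}\mathbf M_\alpha$, $w(x)=(w_\alpha(x))_\alpha$, from $w_\alpha\colon B^k\to\mathbf M_\alpha$ in $D$ ($I$ possibly empty); (D) restricting the codomain of $w\colon B^k\to\mathbf M$ to a submonoid (induced order) containing its image. "Generated" means the least pmf clone (resp. weight coclone) containing the given set (resp. class). -}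

module Defs where

open import Level using (Level; _⊔_; 0ℓ) renaming (suc to lsuc)
open import Data.Nat using (ℕ; zero; suc; _+_; _<_)
open import Data.Fin using (Fin)
open import Data.Vec using (Vec; []; _∷_; lookup; tabulate; transpose; take; drop; map)
open import Data.List using (List)
open import Data.List.Membership.Propositional using (_∈_)
open import Data.List.Relation.Unary.All using (All)
open import Data.Product using (Σ; _×_; _,_; proj₁; proj₂)
open import Data.Sum using (_⊎_)
open import Data.Empty.Polymorphic using (⊥)
open import Function.Bundles using (_⇔_)
open import Relation.Binary.Core using (Rel)
open import Relation.Binary.Structures using (IsPartialOrder; IsPreorder; IsEquivalence)
open import Relation.Binary.PropositionalEquality using (_≡_; refl; sym; trans; cong₂; isEquivalence)
open import Algebra.Structures using (IsMonoid; IsSemigroup; IsMagma)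

-- Equality of elements is a setoid equality _≈_ (needed so that
-- products of pomonoids can be formed without function extensionality).

record Pomonoid (ℓ : Level) : Set (lsuc ℓ) where
  infixl 7 _∙_
  infix 4 _≈_ _≤_
  field
    Carrier        : Set ℓ
    _≈_            : Rel Carrier ℓ
    _≤_            : Rel Carrier ℓ
    _∙_            : Carrier → Carrier → Carrier
    ε              : Carrier
    isPartialOrder : IsPartialOrder _≈_ _≤_
    isMonoid       : IsMonoid _≈_ _∙_ ε
    monoʳ          : ∀ {x y z} → x ≤ y → (x ∙ z) ≤ (y ∙ z)
    monoˡ          : ∀ {x y z} → x ≤ y → (z ∙ x) ≤ (z ∙ y)

  prod : ∀ {n} → Vec Carrier n → Carrier
  prod []       = ε
  prod (x ∷ xs) = x ∙ prod xs

open Pomonoid public using (Carrier)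

record MonoHom {ℓ : Level} (M M' : Pomonoid ℓ) : Set ℓ where
  private
    module M  = Pomonoid M
    module M' = Pomonoid M'
  field
    ⟦_⟧      : M.Carrier → M'.Carrier
    ⟦⟧-cong  : ∀ {x y} → x M.≈ y → ⟦ x ⟧ M'.≈ ⟦ y ⟧
    ⟦⟧-ε     : ⟦ M.ε ⟧ M'.≈ M'.ε
    ⟦⟧-∙     : ∀ x y → ⟦ x M.∙ y ⟧ M'.≈ (⟦ x ⟧ M'.∙ ⟦ y ⟧)
    ⟦⟧-mono  : ∀ {x y} → x M.≤ y → ⟦ x ⟧ M'.≤ ⟦ y ⟧

module _ {ℓ : Level} (I : Set ℓ) (M : I → Pomonoid ℓ) where
  private
    module Mα (α : I) = Pomonoid (M α)

    Car : Set ℓ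
    Car = (α : I) → Mα.Carrier α
    _≈Π_ : Rel Car ℓ
    x ≈Π y = ∀ α → Mα._≈_ α (x α) (y α)
    _≤Π_ : Rel Car ℓ
    x ≤Π y = ∀ α → Mα._≤_ α (x α) (y α)
    _∙Π_ : Car → Car → Car
    (x ∙Π y) α = Mα._∙_ α (x α) (y α)
    εΠ : Car
    εΠ α = Mα.ε α
    module PO (α : I) = IsPartialOrder (Mα.isPartialOrder α)
    module MO (α : I) = IsMonoid (Mα.isMonoid α)

    eqΠ : IsEquivalence _≈Π_
    eqΠ = record { refl  = λ α → PO.Eq.refl α
                 ; sym   = λ p α → PO.Eq.sym α (p α)
                 ; trans = λ p q α → PO.Eq.trans α (p α) (q α) }

  ΠPom : Pomonoid ℓ
  ΠPom = record
    { Carrier = Car ; _≈_ = _≈Π_ ; _≤_ = _≤Π_ ; _∙_ = _∙Π_ ; ε = εΠ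
    ; isPartialOrder = record
        { isPreorder = record
            { isEquivalence = eqΠ
            ; reflexive = λ p α → PO.reflexive α (p α)
            ; trans = λ p q α → PO.trans α (p α) (q α) }
        ; antisym = λ p q α → PO.antisym α (p α) (q α) }
    ; isMonoid = record
        { isSemigroup = record
            { isMagma = record
                { isEquivalence = eqΠ
                ; ∙-cong = λ p q α → MO.∙-cong α (p α) (q α) }
            ; assoc = λ x y z α → MO.assoc α (x α) (y α) (z α) }
        ; identity = (λ x α → MO.identityˡ α (x α)) , (λ x α → MO.identityʳ α (x α)) }
    ; monoʳ = λ p α → Mα.monoʳ α (p α)
    ; monoˡ = λ p α → Mα.monoˡ α (p α) }

module _ {ℓ : Level} (M : Pomonoid ℓ) where
  private
    module M = Pomonoid M
    module PO = IsPartialOrder M.isPartialOrder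
    module MO = IsMonoid M.isMonoid

  SubPom : (P : M.Carrier → Set ℓ) → P M.ε → (∀ {x y} → P x → P y → P (x M.∙ y)) → Pomonoid ℓ
  SubPom P Pε P∙ = record
    { Carrier = Σ M.Carrier P
    ; _≈_ = λ x y → proj₁ x M.≈ proj₁ y
    ; _≤_ = λ x y → proj₁ x M.≤ proj₁ y
    ; _∙_ = λ x y → (proj₁ x M.∙ proj₁ y) , P∙ (proj₂ x) (proj₂ y)
    ; ε = M.ε , Pε
    ; isPartialOrder = record
        { isPreorder = record
            { isEquivalence = eqS ; reflexive = PO.reflexive ; trans = PO.trans }
        ; antisym = PO.antisym }
    ; isMonoid = record
        { isSemigroup = record
            { isMagma = record { isEquivalence = eqS ; ∙-cong = MO.∙-cong }
            ; assoc = λ x y z → MO.assoc (proj₁ x) (proj₁ y) (proj₁ z) }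
        ; identity = (λ x → MO.identityˡ (proj₁ x)) , (λ x → MO.identityʳ (proj₁ x)) }
    ; monoʳ = M.monoʳ
    ; monoˡ = M.monoˡ }
    where
    eqS : IsEquivalence {A = Σ M.Carrier P} (λ x y → proj₁ x M.≈ proj₁ y)
    eqS = record { refl = PO.Eq.refl ; sym = PO.Eq.sym ; trans = PO.Eq.trans }

data Two {ℓ : Level} : Set ℓ where
  𝟘 𝟙 : Two

_∧₂_ : ∀ {ℓ} → Two {ℓ} → Two {ℓ} → Two {ℓ}
𝟘 ∧₂ y = 𝟘
𝟙 ∧₂ y = y

data _≤₂_ {ℓ : Level} : Two {ℓ} → Two {ℓ} → Set ℓ where
  0≤ : ∀ {y} → 𝟘 ≤₂ y
  1≤1 : 𝟙 ≤₂ 𝟙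

data Shape : Set where
  dom cod both : Shape

RightShape : Shape → ℕ → ℕ → Set
RightShape dom  n m = 0 < n
RightShape cod  n m = 0 < m
RightShape both n m = (0 < n) × (0 < m)

TwoOrd : ∀ {ℓ} → Shape → Rel (Two {ℓ}) ℓ
TwoOrd dom  x y = x ≤₂ y
TwoOrd cod  x y = y ≤₂ x
TwoOrd both x y = x ≡ y

private
  module _ {ℓ : Level} where
    ≤₂-refl : ∀ {x y : Two {ℓ}} → x ≡ y → x ≤₂ y
    ≤₂-refl {x = 𝟘} refl = 0≤
    ≤₂-refl {x = 𝟙} refl = 1≤1

    ≤₂-trans : ∀ {x y z : Two {ℓ}} → x ≤₂ y → y ≤₂ z → x ≤₂ z
    ≤₂-trans 0≤ q = 0≤
    ≤₂-trans 1≤1 q = q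

    ≤₂-antisym : ∀ {x y : Two {ℓ}} → x ≤₂ y → y ≤₂ x → x ≡ y
    ≤₂-antisym 0≤ 0≤ = refl
    ≤₂-antisym 1≤1 _ = refl

    ≤₂-monoʳ : ∀ {x y z : Two {ℓ}} → x ≤₂ y → (x ∧₂ z) ≤₂ (y ∧₂ z)
    ≤₂-monoʳ 0≤ = 0≤
    ≤₂-monoʳ 1≤1 = ≤₂-refl refl

    ≤₂-monoˡ : ∀ {x y : Two {ℓ}} (z : Two {ℓ}) → x ≤₂ y → (z ∧₂ x) ≤₂ (z ∧₂ y)
    ≤₂-monoˡ 𝟘 p = 0≤
    ≤₂-monoˡ 𝟙 p = p

    ∧-assoc : ∀ (x y z : Two {ℓ}) → ((x ∧₂ y) ∧₂ z) ≡ (x ∧₂ (y ∧₂ z))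
    ∧-assoc 𝟘 y z = refl
    ∧-assoc 𝟙 y z = refl

    ∧-idʳ : ∀ (x : Two {ℓ}) → (x ∧₂ 𝟙) ≡ x
    ∧-idʳ 𝟘 = refl
    ∧-idʳ 𝟙 = refl

    two-isMonoid : IsMonoid {A = Two {ℓ}} _≡_ _∧₂_ 𝟙
    two-isMonoid = record
      { isSemigroup = record
          { isMagma = record { isEquivalence = isEquivalence ; ∙-cong = cong₂ _∧₂_ }
          ; assoc = ∧-assoc }
      ; identity = (λ x → refl) , ∧-idʳ }

    ord-po : (s : Shape) → IsPartialOrder {A = Two {ℓ}} _≡_ (TwoOrd s)
    ord-po dom = record
      { isPreorder = record { isEquivalence = isEquivalence ; reflexive = ≤₂-refl ; trans = ≤₂-trans }
      ; antisym = ≤₂-antisym }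
    ord-po cod = record
      { isPreorder = record { isEquivalence = isEquivalence
                            ; reflexive = λ p → ≤₂-refl (sym p) ; trans = λ p q → ≤₂-trans q p }
      ; antisym = λ p q → ≤₂-antisym q p }
    ord-po both = record
      { isPreorder = record { isEquivalence = isEquivalence ; reflexive = λ p → p ; trans = trans }
      ; antisym = λ p q → p }

    ord-monoʳ : (s : Shape) → ∀ {x y z : Two {ℓ}} → TwoOrd s x y → TwoOrd s (x ∧₂ z) (y ∧₂ z)
    ord-monoʳ dom p = ≤₂-monoʳ p
    ord-monoʳ cod p = ≤₂-monoʳ p
    ord-monoʳ both refl = refl

    ord-monoˡ : (s : Shape) → ∀ {x y z : Two {ℓ}} → TwoOrd s x y → TwoOrd s (z ∧₂ x) (z ∧₂ y)
    ord-monoˡ dom {z = z} p = ≤₂-monoˡ z p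
    ord-monoˡ cod {z = z} p = ≤₂-monoˡ z p
    ord-monoˡ both refl = refl

TwoPom : ∀ {ℓ} → Shape → Pomonoid ℓ
TwoPom {ℓ} s = record
  { Carrier = Two {ℓ} ; _≈_ = _≡_ ; _≤_ = TwoOrd s ; _∙_ = _∧₂_ ; ε = 𝟙
  ; isPartialOrder = ord-po s ; isMonoid = two-isMonoid
  ; monoʳ = ord-monoʳ s ; monoˡ = ord-monoˡ s }

module _ {ℓ : Level} (B : Set ℓ) where

  Pmf : ℕ → ℕ → Set (lsuc ℓ)
  Pmf n m = Vec B n → Vec B m → Set ℓ

  PmfSet : Set (lsuc (lsuc ℓ))
  PmfSet = (n m : ℕ) → Pmf n m → Set (lsuc ℓ)

  idPmf : (n : ℕ) → Pmf n n
  idPmf n x y = x ≡ y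

  emptyPmf : (n m : ℕ) → Pmf n m
  emptyPmf n m x y = ⊥

  _∘P_ : ∀ {n m p} → Pmf m p → Pmf n m → Pmf n p
  (g ∘P f) x z = Σ (Vec B _) (λ y → f x y × g y z)

  _×P_ : ∀ {n m n' m'} → Pmf n m → Pmf n' m' → Pmf (n + n') (m + m')
  _×P_ {n} {m} f g u v = f (take n u) (take m v) × g (drop n u) (drop m v)

  finPmf : ∀ {n m} → List (Vec B n × Vec B m) → Pmf n m
  finPmf L x y = (x , y) ∈ L

  record IsPmfClone (C : PmfSet) : Set (lsuc ℓ) where
    field
      finitary : ∀ n m (f : Pmf n m) →
        C n m f ⇔ (∀ (L : List (Vec B n × Vec B m)) →
                     All (λ p → f (proj₁ p) (proj₂ p)) L → C n m (finPmf L))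
      ids     : ∀ n → C n n (idPmf n)
      comp    : ∀ n m p (f : Pmf n m) (g : Pmf m p) → C n m f → C m p g → C n p (g ∘P f)
      prodCl  : ∀ n m n' m' (f : Pmf n m) (g : Pmf n' m') →
                  C n m f → C n' m' g → C (n + n') (m + m') (f ×P g)

  _⊆P_ : PmfSet → PmfSet → Set (lsuc ℓ)
  S ⊆P C = ∀ n m f → S n m f → C n m f

  record IsGeneratedClone (S C : PmfSet) : Set (lsuc (lsuc ℓ)) where
    field
      isClone : IsPmfClone C
      incl    : S ⊆P C
      least   : ∀ (E : PmfSet) → IsPmfClone E → S ⊆P E → C ⊆P E

  record Weight : Set (lsuc ℓ) where
    constructor weight
    field
      arity : ℕ
      codom : Pomonoid ℓ
      fun   : Vec B arity → Carrier codom
  open Weight public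

  WgtClass : Set (lsuc (lsuc ℓ))
  WgtClass = Weight → Set (lsuc ℓ)

  Trivial : Weight → Set ℓ
  Trivial w = ∀ x → Pomonoid._≈_ (codom w) (fun w x) (Pomonoid.ε (codom w))

  -- f : B^n ⇉ B^m preserves w : B^k → M.  Matrices a ∈ B^{k×n} are given
  -- by their k rows; 'transpose a' is the vector of the n columns.
  Preserves : ∀ {n m} → Pmf n m → Weight → Set ℓ
  Preserves {n} {m} f w =
    ∀ (a : Vec (Vec B n) (arity w)) (b : Vec (Vec B m) (arity w)) →
      (∀ (j : Fin (arity w)) → f (lookup a j) (lookup b j)) →
      prod (map (fun w) (transpose a)) ≤ prod (map (fun w) (transpose b))
    where open Pomonoid (codom w)

  Pol : WgtClass → PmfSet
  Pol D n m f = ∀ (w : Weight) → D w → Preserves f w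

  Inv : PmfSet → WgtClass
  Inv C w = ∀ n m (f : Pmf n m) → C n m f → Preserves f w

  record IsWeightCoclone (D : WgtClass) : Set (lsuc ℓ) where
    field
      reindex : ∀ (w : Weight) k' (ρ : Fin (arity w) → Fin k') → D w →
                  D (weight k' (codom w) (λ x → fun w (tabulate (λ i → lookup x (ρ i)))))
      hom     : ∀ (w : Weight) (M' : Pomonoid ℓ) (φ : MonoHom (codom w) M') → D w →
                  D (weight (arity w) M' (λ x → MonoHom.⟦_⟧ φ (fun w x)))
      -- (C) products (I possibly empty)
      product : ∀ k (I : Set ℓ) (M : I → Pomonoid ℓ) (ws : (α : I) → Vec B k → Carrier (M α)) →
                  (∀ α → D (weight k (M α) (ws α))) →
                  D (weight k (ΠPom I M) (λ x α → ws α x))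
      restrict : ∀ (w : Weight) (P : Carrier (codom w) → Set ℓ)
                   (Pε : P (Pomonoid.ε (codom w)))
                   (P∙ : ∀ {x y} → P x → P y → P (Pomonoid._∙_ (codom w) x y))
                   (img : ∀ x → P (fun w x)) → D w →
                  D (weight (arity w) (SubPom (codom w) P Pε P∙) (λ x → fun w x , img x))
      -- weights are functions: D does not distinguish pointwise equal weights
      extensional : ∀ k (M : Pomonoid ℓ) (g h : Vec B k → Carrier M) →
                  (∀ x → Pomonoid._≈_ M (g x) (h x)) → D (weight k M g) → D (weight k M h)

  _⊆W_ : WgtClass → WgtClass → Set (lsuc ℓ)
  S ⊆W D = ∀ w → S w → D w

  record IsGeneratedCoclone (S D : WgtClass) : Set (lsuc (lsuc ℓ)) where
    field
      isCoclone : IsWeightCoclone D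
      incl      : S ⊆W D
      least     : ∀ (E : WgtClass) → IsWeightCoclone E → S ⊆W E → D ⊆W E

  cst₀ : Shape → Weight
  cst₀ s = weight 0 (TwoPom s) (λ _ → 𝟘)

-- Since C = Pol D and D = Inv C, C is a pmf clone and D a weight coclone.
-- For (1), the pmf of the right shape together with the pmf B⁰ ⇉ B⁰ form a clone,
-- and every clone contains every pmf B⁰ ⇉ B⁰ since any such pmf is contained in
-- id₀; moreover f preserves cst₀ exactly when the products 0ⁿ and 0ᵐ are in the
-- order chosen by the shape.  For (2), the weights that are trivial or of positive
-- arity form a coclone, every coclone contains the trivial weights (an empty
-- product followed by a homomorphism to the unit), the empty pmf preserve exactly
-- these weights, and a nullary weight with value x is preserved by ∅ : B⁰ ⇉ B¹
-- and ∅ : B¹ ⇉ B⁰ iff 1 ≤ x ≤ 1.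

module Submission where

open import Defs
open import Level using (Level; Lift; lift; lower) renaming (suc to lsuc)
open import Data.Nat using (ℕ; zero; suc; _+_; _<_; z≤n; s≤s)
open import Data.Fin using (Fin; fromℕ<)
open import Data.Vec using (Vec; []; _∷_; _++_; lookup; tabulate; transpose; take; drop; map; replicate; zipWith)
open import Data.Vec.Properties
  using (lookup-map; lookup-zipWith; lookup-replicate; lookup∘tabulate; tabulate∘lookup; tabulate-cong; tabulate-∘;
         map-∘; map-++; zipWith-is-⊛; zipWith-++; take++drop≡id)
import Data.List as List
open import Data.List.Relation.Unary.All as All using (All)
open import Data.List.Relation.Unary.All.Properties using (tabulate⁺)
open import Data.List.Membership.Propositional.Properties using (∈-tabulate⁺)
open import Data.Product using (Σ; _×_; _,_; proj₁; proj₂)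
open import Data.Sum using (_⊎_; inj₁; inj₂)
open import Data.Empty.Polymorphic using (⊥; ⊥-elim)
open import Function using (_∘_)
open import Function.Bundles using (_⇔_; mk⇔; Equivalence)
open import Relation.Binary.Structures using (IsPartialOrder)
open import Algebra.Structures using (IsMonoid)
open import Relation.Binary.PropositionalEquality using (_≡_; refl; sym; trans; cong; cong₂; subst; subst₂)
open import Relation.Binary.PropositionalEquality.Properties using (module ≡-Reasoning)

open Equivalence using (to; from)

module PomonoidProperties {ℓ : Level} (M : Pomonoid ℓ) where
  open Pomonoid M hiding (Carrier)
  open IsPartialOrder isPartialOrder public
    using (≲-respˡ-≈; ≲-respʳ-≈; antisym) renaming (refl to ≤-refl; trans to ≤-trans; module Eq to ≈)
  open IsMonoid isMonoid public using (∙-cong; assoc; identityˡ; identityʳ)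

  ∙-mono : ∀ {x x' y y'} → x ≤ x' → y ≤ y' → x ∙ y ≤ x' ∙ y'
  ∙-mono x≤x' y≤y' = ≤-trans (monoʳ x≤x') (monoˡ y≤y')

  prod-++ : ∀ {n n'} (xs : Vec (Carrier M) n) (ys : Vec (Carrier M) n') → prod (xs ++ ys) ≈ prod xs ∙ prod ys
  prod-++ []       ys = ≈.sym (identityˡ (prod ys))
  prod-++ (x ∷ xs) ys = ≈.trans (∙-cong ≈.refl (prod-++ xs ys)) (≈.sym (assoc x (prod xs) (prod ys)))

  prod-map-cong : ∀ {a} {A : Set a} {g h : A → Carrier M} → (∀ x → g x ≈ h x) →
                  ∀ {n} (xs : Vec A n) → prod (map g xs) ≈ prod (map h xs)
  prod-map-cong g≈h []       = ≈.refl
  prod-map-cong g≈h (x ∷ xs) = ∙-cong (g≈h x) (prod-map-cong g≈h xs)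

  prod-map-ε : ∀ {a} {A : Set a} {g : A → Carrier M} → (∀ x → g x ≈ ε) →
               ∀ {n} (xs : Vec A n) → prod (map g xs) ≈ ε
  prod-map-ε g≈ε []       = ≈.refl
  prod-map-ε g≈ε (x ∷ xs) = ≈.trans (∙-cong (g≈ε x) (prod-map-ε g≈ε xs)) (identityˡ ε)

prod-hom : ∀ {ℓ} {M M' : Pomonoid ℓ} (φ : MonoHom M M') {n} (xs : Vec (Carrier M) n) →
           Pomonoid._≈_ M' (MonoHom.⟦_⟧ φ (Pomonoid.prod M xs)) (Pomonoid.prod M' (map (MonoHom.⟦_⟧ φ) xs))
prod-hom φ []       = MonoHom.⟦⟧-ε φ
prod-hom {M' = M'} φ (x ∷ xs) =
  ≈.trans (MonoHom.⟦⟧-∙ φ x _) (∙-cong ≈.refl (prod-hom φ xs))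
  where open PomonoidProperties M'

prod-Π : ∀ {ℓ} (I : Set ℓ) (M : I → Pomonoid ℓ) {n} (xs : Vec (Carrier (ΠPom I M)) n) (α : I) →
         Pomonoid.prod (ΠPom I M) xs α ≡ Pomonoid.prod (M α) (map (λ x → x α) xs)
prod-Π I M []       α = refl
prod-Π I M (x ∷ xs) α = cong (Pomonoid._∙_ (M α) (x α)) (prod-Π I M xs α)

prod-SubPom : ∀ {ℓ} (M : Pomonoid ℓ) (P : Carrier M → Set ℓ) (Pε : P (Pomonoid.ε M))
              (P∙ : ∀ {x y} → P x → P y → P (Pomonoid._∙_ M x y)) {n} (xs : Vec (Carrier (SubPom M P Pε P∙)) n) →
              proj₁ (Pomonoid.prod (SubPom M P Pε P∙) xs) ≡ Pomonoid.prod M (map proj₁ xs)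
prod-SubPom M P Pε P∙ []       = refl
prod-SubPom M P Pε P∙ (x ∷ xs) = cong (Pomonoid._∙_ M (proj₁ x)) (prod-SubPom M P Pε P∙ xs)

≡-lookup : ∀ {a} {A : Set a} {k} {u v : Vec A k} → (∀ j → lookup u j ≡ lookup v j) → u ≡ v
≡-lookup {u = u} {v} u≗v = trans (sym (tabulate∘lookup u)) (trans (tabulate-cong u≗v) (tabulate∘lookup v))

replicate-++ : ∀ {a} {A : Set a} n {n'} (x : A) → replicate (n + n') x ≡ replicate n x ++ replicate n' x
replicate-++ zero    x = refl
replicate-++ (suc n) x = cong (x ∷_) (replicate-++ n x)

module _ {a} {A : Set a} where

  transpose-∷ : ∀ {n k} (x : Vec A n) (a : Vec (Vec A n) k) → transpose (x ∷ a) ≡ zipWith _∷_ x (transpose a)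
  transpose-∷ x a = sym (zipWith-is-⊛ _∷_ x (transpose a))

  lookup-transpose : ∀ {n k} (a : Vec (Vec A n) k) (c : Fin n) → lookup (transpose a) c ≡ map (λ r → lookup r c) a
  lookup-transpose []      c = lookup-replicate c []
  lookup-transpose (x ∷ a) c = begin
    lookup (transpose (x ∷ a)) c            ≡⟨ cong (λ t → lookup t c) (transpose-∷ x a) ⟩
    lookup (zipWith _∷_ x (transpose a)) c  ≡⟨ lookup-zipWith _∷_ c x (transpose a) ⟩
    lookup x c ∷ lookup (transpose a) c     ≡⟨ cong (lookup x c ∷_) (lookup-transpose a c) ⟩
    map (λ r → lookup r c) (x ∷ a)          ∎
    where open ≡-Reasoning

  transpose-split : ∀ n {n' k} (a : Vec (Vec A (n + n')) k) →
                    transpose a ≡ transpose (map (take n) a) ++ transpose (map (drop n) a)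
  transpose-split n []      = replicate-++ n []
  transpose-split n {n'} {suc k} (x ∷ a) = begin
    transpose (x ∷ a)
      ≡⟨ transpose-∷ x a ⟩
    zipWith _∷_ x (transpose a)
      ≡⟨ cong₂ (zipWith _∷_) (sym (take++drop≡id n x)) (transpose-split n a) ⟩
    zipWith _∷_ (take n x ++ drop n x) (tl ++ tr)
      ≡⟨ zipWith-++ _∷_ (take n x) (drop n x) tl tr ⟩
    zipWith _∷_ (take n x) tl ++ zipWith _∷_ (drop n x) tr
      ≡⟨ sym (cong₂ _++_ (transpose-∷ (take n x) (map (take n) a)) (transpose-∷ (drop n x) (map (drop n) a))) ⟩
    transpose (map (take n) (x ∷ a)) ++ transpose (map (drop n) (x ∷ a)) ∎
    where
      open ≡-Reasoning
      tl : Vec (Vec A k) n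
      tl = transpose (map (take n) a)
      tr : Vec (Vec A k) n'
      tr = transpose (map (drop n) a)

  transpose-reindex : ∀ {n k k'} (ρ : Fin k → Fin k') (a : Vec (Vec A n) k') →
                      transpose (tabulate (λ i → lookup a (ρ i)))
                        ≡ map (λ x → tabulate (λ i → lookup x (ρ i))) (transpose a)
  transpose-reindex ρ a = ≡-lookup λ c → begin
    lookup (transpose (tabulate (λ i → lookup a (ρ i)))) c
      ≡⟨ lookup-transpose _ c ⟩
    map (λ r → lookup r c) (tabulate (λ i → lookup a (ρ i)))
      ≡⟨ sym (tabulate-∘ _ _) ⟩
    tabulate (λ i → lookup (lookup a (ρ i)) c)
      ≡⟨ tabulate-cong (λ i → sym (lookup-map (ρ i) _ a)) ⟩
    tabulate (λ i → lookup (map (λ r → lookup r c) a) (ρ i))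
      ≡⟨ cong (λ x → tabulate (λ i → lookup x (ρ i))) (sym (lookup-transpose a c)) ⟩
    tabulate (λ i → lookup (lookup (transpose a) c) (ρ i))
      ≡⟨ sym (lookup-map c _ (transpose a)) ⟩
    lookup (map (λ x → tabulate (λ i → lookup x (ρ i))) (transpose a)) c ∎
    where open ≡-Reasoning

module _ {ℓ : Level} {B : Set ℓ} where

  ∏ : (w : Weight B) {n : ℕ} → Vec (Vec B n) (arity w) → Carrier (codom w)
  ∏ w a = Pomonoid.prod (codom w) (map (fun w) (transpose a))

  Graph : ∀ {n m} → Pmf B n m → Vec B n × Vec B m → Set ℓ
  Graph f (x , y) = f x y

  lookup-map₂ : ∀ {n m n' m' k} {h : Vec B n → Vec B n'} {h' : Vec B m → Vec B m'} (R : Pmf B n' m')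
                (a : Vec (Vec B n) k) (b : Vec (Vec B m) k) →
                (∀ j → R (h (lookup a j)) (h' (lookup b j))) → ∀ j → R (lookup (map h a) j) (lookup (map h' b) j)
  lookup-map₂ R a b R-ab j = subst₂ R (sym (lookup-map j _ a)) (sym (lookup-map j _ b)) (R-ab j)

  module _ (w : Weight B) where
    open Pomonoid (codom w) using (_≤_; _≈_; _∙_)
    open PomonoidProperties (codom w)

    preserves-id : ∀ n → Preserves B (idPmf B n) w
    preserves-id n a b a≡b = subst (λ b → ∏ w a ≤ ∏ w b) (≡-lookup {u = a} {v = b} a≡b) ≤-refl

    preserves-∘ : ∀ {n m p} {f : Pmf B n m} {g : Pmf B m p} →
                  Preserves B f w → Preserves B g w → Preserves B (_∘P_ B g f) w
    preserves-∘ {m = m} {f = f} {g} f-pres g-pres a c gf = ≤-trans (f-pres a b f-ab) (g-pres b c g-bc)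
      where
        b : Vec (Vec B m) (arity w)
        b = tabulate (λ j → proj₁ (gf j))
        f-ab : ∀ j → f (lookup a j) (lookup b j)
        f-ab j = subst (f (lookup a j)) (sym (lookup∘tabulate _ j)) (proj₁ (proj₂ (gf j)))
        g-bc : ∀ j → g (lookup b j) (lookup c j)
        g-bc j = subst (λ y → g y (lookup c j)) (sym (lookup∘tabulate _ j)) (proj₂ (proj₂ (gf j)))

    ∏-split : ∀ n {n'} (a : Vec (Vec B (n + n')) (arity w)) → ∏ w a ≈ ∏ w (map (take n) a) ∙ ∏ w (map (drop n) a)
    ∏-split n {n'} a = ≈.trans (≈.reflexive (cong (Pomonoid.prod (codom w)) columns-split))
                          (prod-++ (map (fun w) tl) (map (fun w) tr))
      where
        tl : Vec (Vec B (arity w)) n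
        tl = transpose (map (take n) a)
        tr : Vec (Vec B (arity w)) n'
        tr = transpose (map (drop n) a)
        columns-split : map (fun w) (transpose a) ≡ map (fun w) tl ++ map (fun w) tr
        columns-split = trans (cong (map (fun w)) (transpose-split n a)) (map-++ (fun w) tl tr)

    preserves-× : ∀ {n m n' m'} {f : Pmf B n m} {g : Pmf B n' m'} →
                  Preserves B f w → Preserves B g w → Preserves B (_×P_ B f g) w
    preserves-× {n} {m} {f = f} {g} f-pres g-pres a b fg =
      ≲-respˡ-≈ (≈.sym (∏-split n a)) (≲-respʳ-≈ (≈.sym (∏-split m b))
        (∙-mono (f-pres (map (take n) a) (map (take m) b) (lookup-map₂ f a b (proj₁ ∘ fg)))
                (g-pres (map (drop n) a) (map (drop m) b) (lookup-map₂ g a b (proj₂ ∘ fg)))))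

    preserves-⊆ : ∀ {n m} {f g : Pmf B n m} → (∀ x y → f x y → g x y) → Preserves B g w → Preserves B f w
    preserves-⊆ f⊆g g-pres a b f-ab = g-pres a b (λ j → f⊆g _ _ (f-ab j))

    -- Only the finitely many row pairs of a given a, b are ever inspected.
    preserves-finitary : ∀ {n m} {f : Pmf B n m} →
                         (∀ L → All (Graph f) L → Preserves B (finPmf B L) w) → Preserves B f w
    preserves-finitary {n} {m} fin-pres a b f-ab =
      fin-pres (List.tabulate rows) (tabulate⁺ f-ab) a b (λ j → ∈-tabulate⁺ j)
      where
        rows : Fin (arity w) → Vec B n × Vec B m
        rows j = lookup a j , lookup b j

  module _ {n m : ℕ} (f : Pmf B n m) where

    preserves-reindex : ∀ (w : Weight B) k' (ρ : Fin (arity w) → Fin k') → Preserves B f w →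
                        Preserves B f (weight k' (codom w) (λ x → fun w (tabulate (λ i → lookup x (ρ i)))))
    preserves-reindex w k' ρ w-pres a b f-ab =
      subst₂ (Pomonoid._≤_ (codom w)) (∏-reindex a) (∏-reindex b)
        (w-pres (reindex a) (reindex b) (λ i → subst₂ f (sym (lookup∘tabulate _ i)) (sym (lookup∘tabulate _ i)) (f-ab (ρ i))))
      where
        reindex : ∀ {p} → Vec (Vec B p) k' → Vec (Vec B p) (arity w)
        reindex a = tabulate (λ i → lookup a (ρ i))
        ∏-reindex : ∀ {p} (a : Vec (Vec B p) k') →
                    ∏ w (reindex a) ≡ Pomonoid.prod (codom w) (map (λ x → fun w (tabulate (λ i → lookup x (ρ i)))) (transpose a))
        ∏-reindex a = cong (Pomonoid.prod (codom w))
                        (trans (cong (map (fun w)) (transpose-reindex ρ a)) (sym (map-∘ (fun w) _ (transpose a))))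

    preserves-hom : ∀ (w : Weight B) (M' : Pomonoid ℓ) (φ : MonoHom (codom w) M') → Preserves B f w →
                    Preserves B f (weight (arity w) M' (λ x → MonoHom.⟦_⟧ φ (fun w x)))
    preserves-hom w M' φ w-pres a b f-ab =
      ≲-respˡ-≈ (∏-hom a) (≲-respʳ-≈ (∏-hom b) (MonoHom.⟦⟧-mono φ (w-pres a b f-ab)))
      where
        open PomonoidProperties M'
        ∏-hom : ∀ {p} (a : Vec (Vec B p) (arity w)) →
                Pomonoid._≈_ M' (MonoHom.⟦_⟧ φ (∏ w a)) (Pomonoid.prod M' (map (λ x → MonoHom.⟦_⟧ φ (fun w x)) (transpose a)))
        ∏-hom a = ≈.trans (prod-hom φ (map (fun w) (transpose a)))
                          (≈.reflexive (cong (Pomonoid.prod M') (sym (map-∘ (MonoHom.⟦_⟧ φ) (fun w) (transpose a)))))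

    preserves-Π : ∀ k (I : Set ℓ) (M : I → Pomonoid ℓ) (ws : (α : I) → Vec B k → Carrier (M α)) →
                  (∀ α → Preserves B f (weight k (M α) (ws α))) → Preserves B f (weight k (ΠPom I M) (λ x α → ws α x))
    preserves-Π k I M ws ws-pres a b f-ab α =
      subst₂ (Pomonoid._≤_ (M α)) (sym (∏-Π a)) (sym (∏-Π b)) (ws-pres α a b f-ab)
      where
        ∏-Π : ∀ {p} (a : Vec (Vec B p) k) →
              Pomonoid.prod (ΠPom I M) (map (λ x α → ws α x) (transpose a)) α ≡ Pomonoid.prod (M α) (map (ws α) (transpose a))
        ∏-Π a = trans (prod-Π I M (map (λ x α → ws α x) (transpose a)) α)
                      (cong (Pomonoid.prod (M α)) (sym (map-∘ (λ x → x α) (λ x α → ws α x) (transpose a))))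

    preserves-restrict : ∀ (w : Weight B) (P : Carrier (codom w) → Set ℓ) (Pε : P (Pomonoid.ε (codom w)))
                         (P∙ : ∀ {x y} → P x → P y → P (Pomonoid._∙_ (codom w) x y)) (img : ∀ x → P (fun w x)) →
                         Preserves B f w → Preserves B f (weight (arity w) (SubPom (codom w) P Pε P∙) (λ x → fun w x , img x))
    preserves-restrict w P Pε P∙ img w-pres a b f-ab =
      subst₂ (Pomonoid._≤_ (codom w)) (sym (∏-restrict a)) (sym (∏-restrict b)) (w-pres a b f-ab)
      where
        restricted : Vec B (arity w) → Carrier (SubPom (codom w) P Pε P∙)
        restricted x = fun w x , img x
        ∏-restrict : ∀ {p} (a : Vec (Vec B p) (arity w)) →
                     proj₁ (Pomonoid.prod (SubPom (codom w) P Pε P∙) (map restricted (transpose a))) ≡ ∏ w a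
        ∏-restrict a = trans (prod-SubPom (codom w) P Pε P∙ (map restricted (transpose a)))
                             (cong (Pomonoid.prod (codom w)) (sym (map-∘ proj₁ restricted (transpose a))))

    preserves-≈ : ∀ k (M : Pomonoid ℓ) (g h : Vec B k → Carrier M) → (∀ x → Pomonoid._≈_ M (g x) (h x)) →
                  Preserves B f (weight k M g) → Preserves B f (weight k M h)
    preserves-≈ k M g h g≈h g-pres a b f-ab =
      ≲-respˡ-≈ (prod-map-cong g≈h (transpose a)) (≲-respʳ-≈ (prod-map-cong g≈h (transpose b)) (g-pres a b f-ab))
      where open PomonoidProperties M

  Pol-isPmfClone : (D : WgtClass B) → IsPmfClone B (Pol B D)
  Pol-isPmfClone D = record
    { finitary = λ n m f → mk⇔
        (λ f-pol L L⊆f w Dw → preserves-⊆ w {f = finPmf B L} {g = f} (λ x y xy∈L → All.lookup L⊆f xy∈L) (f-pol w Dw))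
        (λ fin-pol w Dw → preserves-finitary w {f = f} (λ L L⊆f → fin-pol L L⊆f w Dw))
    ; ids    = λ n w Dw → preserves-id w n
    ; comp   = λ n m p f g f-pol g-pol w Dw → preserves-∘ w {f = f} {g = g} (f-pol w Dw) (g-pol w Dw)
    ; prodCl = λ n m n' m' f g f-pol g-pol w Dw → preserves-× w {f = f} {g = g} (f-pol w Dw) (g-pol w Dw) }

  Inv-isWeightCoclone : (C : PmfSet B) → IsWeightCoclone B (Inv B C)
  Inv-isWeightCoclone C = record
    { reindex     = λ w k' ρ w-inv n m f Cf → preserves-reindex f w k' ρ (w-inv n m f Cf)
    ; hom         = λ w M' φ w-inv n m f Cf → preserves-hom f w M' φ (w-inv n m f Cf)
    ; product     = λ k I M ws ws-inv n m f Cf → preserves-Π f k I M ws (λ α → ws-inv α n m f Cf)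
    ; restrict    = λ w P Pε P∙ img w-inv n m f Cf → preserves-restrict f w P Pε P∙ img (w-inv n m f Cf)
    ; extensional = λ k M g h g≈h g-inv n m f Cf → preserves-≈ f k M g h g≈h (g-inv n m f Cf) }

  IsPmfClone-resp-⇔ : ∀ {C E : PmfSet B} → (∀ n m f → C n m f ⇔ E n m f) → IsPmfClone B E → IsPmfClone B C
  IsPmfClone-resp-⇔ C⇔E E-clone = record
    { finitary = λ n m f → mk⇔
        (λ Cf L L⊆f → from (C⇔E _ _ _) (to (finitary n m f) (to (C⇔E _ _ _) Cf) L L⊆f))
        (λ fin → from (C⇔E _ _ _) (from (finitary n m f) (λ L L⊆f → to (C⇔E _ _ _) (fin L L⊆f))))
    ; ids    = λ n → from (C⇔E _ _ _) (ids n)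
    ; comp   = λ n m p f g Cf Cg → from (C⇔E _ _ _) (comp n m p f g (to (C⇔E _ _ _) Cf) (to (C⇔E _ _ _) Cg))
    ; prodCl = λ n m n' m' f g Cf Cg → from (C⇔E _ _ _) (prodCl n m n' m' f g (to (C⇔E _ _ _) Cf) (to (C⇔E _ _ _) Cg)) }
    where open IsPmfClone E-clone

  IsWeightCoclone-resp-⇔ : ∀ {D E : WgtClass B} → (∀ w → D w ⇔ E w) → IsWeightCoclone B E → IsWeightCoclone B D
  IsWeightCoclone-resp-⇔ D⇔E E-coclone = record
    { reindex     = λ w k' ρ Dw → from (D⇔E _) (reindex w k' ρ (to (D⇔E _) Dw))
    ; hom         = λ w M' φ Dw → from (D⇔E _) (hom w M' φ (to (D⇔E _) Dw))
    ; product     = λ k I M ws Dws → from (D⇔E _) (product k I M ws (λ α → to (D⇔E _) (Dws α)))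
    ; restrict    = λ w P Pε P∙ img Dw → from (D⇔E _) (restrict w P Pε P∙ img (to (D⇔E _) Dw))
    ; extensional = λ k M g h g≈h Dg → from (D⇔E _) (extensional k M g h g≈h (to (D⇔E _) Dg)) }
    where open IsWeightCoclone E-coclone

RightShapeOr0⇉0 : Shape → ℕ → ℕ → Set
RightShapeOr0⇉0 s n m = RightShape s n m ⊎ (n ≡ 0 × m ≡ 0)

RightShapeOr0⇉0-id : ∀ s n → RightShapeOr0⇉0 s n n
RightShapeOr0⇉0-id s    zero    = inj₂ (refl , refl)
RightShapeOr0⇉0-id dom  (suc n) = inj₁ (s≤s z≤n)
RightShapeOr0⇉0-id cod  (suc n) = inj₁ (s≤s z≤n)
RightShapeOr0⇉0-id both (suc n) = inj₁ (s≤s z≤n , s≤s z≤n)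

RightShapeOr0⇉0-∘ : ∀ s {n m p} → RightShapeOr0⇉0 s n m → RightShapeOr0⇉0 s m p → RightShapeOr0⇉0 s n p
RightShapeOr0⇉0-∘ dom  (inj₁ n>0)           _                    = inj₁ n>0
RightShapeOr0⇉0-∘ dom  (inj₂ (refl , refl)) (inj₁ ())
RightShapeOr0⇉0-∘ dom  (inj₂ (refl , refl)) (inj₂ (refl , refl)) = inj₂ (refl , refl)
RightShapeOr0⇉0-∘ cod  _                    (inj₁ p>0)           = inj₁ p>0
RightShapeOr0⇉0-∘ cod  (inj₁ ())            (inj₂ (refl , refl))
RightShapeOr0⇉0-∘ cod  (inj₂ (refl , refl)) (inj₂ (refl , refl)) = inj₂ (refl , refl)
RightShapeOr0⇉0-∘ both (inj₁ (n>0 , _))     (inj₁ (_ , p>0))     = inj₁ (n>0 , p>0)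
RightShapeOr0⇉0-∘ both (inj₁ (_ , ()))      (inj₂ (refl , refl))
RightShapeOr0⇉0-∘ both (inj₂ (refl , refl)) (inj₁ (() , _))
RightShapeOr0⇉0-∘ both (inj₂ (refl , refl)) (inj₂ (refl , refl)) = inj₂ (refl , refl)

RightShapeOr0⇉0-× : ∀ s {n m n' m'} → RightShapeOr0⇉0 s n m → RightShapeOr0⇉0 s n' m' → RightShapeOr0⇉0 s (n + n') (m + m')
RightShapeOr0⇉0-× dom  (inj₁ (s≤s _))         _  = inj₁ (s≤s z≤n)
RightShapeOr0⇉0-× cod  (inj₁ (s≤s _))         _  = inj₁ (s≤s z≤n)
RightShapeOr0⇉0-× both (inj₁ (s≤s _ , s≤s _)) _  = inj₁ (s≤s z≤n , s≤s z≤n)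
RightShapeOr0⇉0-× s    (inj₂ (refl , refl))   rs = rs

0^ : ∀ {ℓ} → ℕ → Two {ℓ}
0^ zero    = 𝟙
0^ (suc n) = 𝟘

0^-ordered⇒RightShapeOr0⇉0 : ∀ {ℓ} s n m → TwoOrd {ℓ} s (0^ n) (0^ m) → RightShapeOr0⇉0 s n m
0^-ordered⇒RightShapeOr0⇉0 s    zero    zero    _ = inj₂ (refl , refl)
0^-ordered⇒RightShapeOr0⇉0 dom  (suc n) m       _ = inj₁ (s≤s z≤n)
0^-ordered⇒RightShapeOr0⇉0 cod  n       (suc m) _ = inj₁ (s≤s z≤n)
0^-ordered⇒RightShapeOr0⇉0 both (suc n) (suc m) _ = inj₁ (s≤s z≤n , s≤s z≤n)
0^-ordered⇒RightShapeOr0⇉0 dom  zero    (suc m) ()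
0^-ordered⇒RightShapeOr0⇉0 cod  (suc n) zero    ()
0^-ordered⇒RightShapeOr0⇉0 both zero    (suc m) ()
0^-ordered⇒RightShapeOr0⇉0 both (suc n) zero    ()

RightShapeOr0⇉0⇒0^-ordered : ∀ {ℓ} s n m → RightShapeOr0⇉0 s n m → TwoOrd {ℓ} s (0^ n) (0^ m)
RightShapeOr0⇉0⇒0^-ordered dom  zero    zero    _ = 1≤1
RightShapeOr0⇉0⇒0^-ordered cod  zero    zero    _ = 1≤1
RightShapeOr0⇉0⇒0^-ordered both zero    zero    _ = refl
RightShapeOr0⇉0⇒0^-ordered dom  (suc n) m       _ = 0≤
RightShapeOr0⇉0⇒0^-ordered cod  n       (suc m) _ = 0≤
RightShapeOr0⇉0⇒0^-ordered both (suc n) (suc m) _ = refl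
RightShapeOr0⇉0⇒0^-ordered dom  zero    (suc m) (inj₁ ())
RightShapeOr0⇉0⇒0^-ordered dom  zero    (suc m) (inj₂ (_ , ()))
RightShapeOr0⇉0⇒0^-ordered cod  (suc n) zero    (inj₁ ())
RightShapeOr0⇉0⇒0^-ordered cod  (suc n) zero    (inj₂ (() , _))
RightShapeOr0⇉0⇒0^-ordered both zero    (suc m) (inj₁ (() , _))
RightShapeOr0⇉0⇒0^-ordered both zero    (suc m) (inj₂ (_ , ()))
RightShapeOr0⇉0⇒0^-ordered both (suc n) zero    (inj₁ (_ , ()))
RightShapeOr0⇉0⇒0^-ordered both (suc n) zero    (inj₂ (() , _))

module _ {ℓ : Level} {B : Set ℓ} where

  ∏-cst₀ : ∀ s n → ∏ (cst₀ B s) {n} [] ≡ 0^ n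
  ∏-cst₀ s zero    = refl
  ∏-cst₀ s (suc n) = refl

  -- cst₀ is nullary, so the only matrices are a = b = [] and the hypothesis on f is vacuous.
  preserves-cst₀⇔ : ∀ s {n m} (f : Pmf B n m) → Preserves B f (cst₀ B s) ⇔ RightShapeOr0⇉0 s n m
  preserves-cst₀⇔ s {n} {m} f = mk⇔
    (λ f-pres → 0^-ordered⇒RightShapeOr0⇉0 s n m (subst₂ (TwoOrd s) (∏-cst₀ s n) (∏-cst₀ s m) (f-pres [] [] λ ())))
    (λ { rs [] [] _ → subst₂ (TwoOrd s) (sym (∏-cst₀ s n)) (sym (∏-cst₀ s m)) (RightShapeOr0⇉0⇒0^-ordered s n m rs) })

  RightShapeOr0⇉0-isPmfClone : ∀ s → IsPmfClone B (λ n m _ → Lift (lsuc ℓ) (RightShapeOr0⇉0 s n m))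
  RightShapeOr0⇉0-isPmfClone s = record
    { finitary = λ n m f → mk⇔ (λ rs _ _ → rs) (λ fin → fin List.[] All.[])
    ; ids      = λ n → lift (RightShapeOr0⇉0-id s n)
    ; comp     = λ n m p f g rs rs' → lift (RightShapeOr0⇉0-∘ s (lower rs) (lower rs'))
    ; prodCl   = λ n m n' m' f g rs rs' → lift (RightShapeOr0⇉0-× s (lower rs) (lower rs')) }

  clone-⊆-closed : ∀ {E : PmfSet B} → IsPmfClone B E → ∀ {n m} {f g : Pmf B n m} →
                   (∀ x y → f x y → g x y) → E n m g → E n m f
  clone-⊆-closed E-clone {n} {m} {f} {g} f⊆g Eg =
    from (finitary n m f) (λ L L⊆f → to (finitary n m g) Eg L (All.map (f⊆g _ _) L⊆f))
    where open IsPmfClone E-clone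

  -- Every pmf B⁰ ⇉ B⁰ is contained in id₀, as B⁰ is a singleton.
  clone-∋-0⇉0 : ∀ {E : PmfSet B} → IsPmfClone B E → (f : Pmf B 0 0) → E 0 0 f
  clone-∋-0⇉0 E-clone f = clone-⊆-closed E-clone (λ { [] [] _ → refl }) (IsPmfClone.ids E-clone 0)

  generatedByRightShape⇔ : ∀ s {C : PmfSet B} → IsPmfClone B C →
    Σ (PmfSet B) (λ S → (∀ n m f → S n m f → RightShape s n m) × IsGeneratedClone B S C)
      ⇔ (∀ n m (f : Pmf B n m) → C n m f → RightShapeOr0⇉0 s n m)
  generatedByRightShape⇔ s {C} C-clone = mk⇔
    (λ { (S , S-rs , gen) n m f Cf → lower (IsGeneratedClone.least gen _ (RightShapeOr0⇉0-isPmfClone s)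
                                              (λ n m f Sf → lift (inj₁ (S-rs n m f Sf))) n m f Cf) })
    (λ C-rs → S , (λ n m f → lower ∘ proj₂) ,
              record { isClone = C-clone
                     ; incl    = λ n m f → proj₁
                     ; least   = λ E E-clone S⊆E n m f Cf → S-generates E E-clone S⊆E Cf (C-rs n m f Cf) })
    where
      S : PmfSet B
      S n m f = C n m f × Lift (lsuc ℓ) (RightShape s n m)
      S-generates : ∀ E → IsPmfClone B E → (∀ n m f → S n m f → E n m f) →
                    ∀ {n m f} → C n m f → RightShapeOr0⇉0 s n m → E n m f
      S-generates E E-clone S⊆E Cf (inj₁ rs)                     = S⊆E _ _ _ (Cf , lift rs)
      S-generates E E-clone S⊆E {f = f} Cf (inj₂ (refl , refl)) = clone-∋-0⇉0 E-clone f

  TrivialOrPositive : Weight B → Set ℓ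
  TrivialOrPositive w = Trivial B w ⊎ 0 < arity w

  TrivialOrPositive-isWeightCoclone : IsWeightCoclone B (Lift (lsuc ℓ) ∘ TrivialOrPositive)
  TrivialOrPositive-isWeightCoclone = record
    { reindex     = reindex
    ; hom         = λ { w M' φ (lift (inj₁ triv)) →
                            lift (inj₁ λ x → Pom.≈.trans M' (MonoHom.⟦⟧-cong φ (triv x)) (MonoHom.⟦⟧-ε φ))
                      ; w M' φ (lift (inj₂ k>0)) → lift (inj₂ k>0) }
    ; product     = product
    ; restrict    = λ w P Pε P∙ img tp → tp
    ; extensional = λ { k M g h g≈h (lift (inj₁ triv)) → lift (inj₁ λ x → Pom.≈.trans M (Pom.≈.sym M (g≈h x)) (triv x))
                      ; k M g h g≈h (lift (inj₂ k>0))  → lift (inj₂ k>0) } }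
    where
      module Pom = PomonoidProperties

      reindex : ∀ (w : Weight B) k' (ρ : Fin (arity w) → Fin k') → Lift (lsuc ℓ) (TrivialOrPositive w) →
                Lift (lsuc ℓ) (TrivialOrPositive (weight k' (codom w) (λ x → fun w (tabulate (λ i → lookup x (ρ i))))))
      reindex w (suc k') ρ _                  = lift (inj₂ (s≤s z≤n))
      reindex w zero     ρ (lift (inj₁ triv)) = lift (inj₁ λ x → triv _)
      reindex w zero     ρ (lift (inj₂ k>0))  with ρ (fromℕ< k>0)
      ... | ()

      product : ∀ k (I : Set ℓ) (M : I → Pomonoid ℓ) (ws : (α : I) → Vec B k → Carrier (M α)) →
                (∀ α → Lift (lsuc ℓ) (TrivialOrPositive (weight k (M α) (ws α)))) →
                Lift (lsuc ℓ) (TrivialOrPositive (weight k (ΠPom I M) (λ x α → ws α x)))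
      product (suc k) I M ws _    = lift (inj₂ (s≤s z≤n))
      product zero    I M ws ws-t = lift (inj₁ λ x α → nullary-trivial (M α) (ws α) (lower (ws-t α)) x)
        where
          nullary-trivial : ∀ (M : Pomonoid ℓ) g → TrivialOrPositive (weight 0 M g) → Trivial B (weight 0 M g)
          nullary-trivial M g (inj₁ triv) = triv

  -- Up to pointwise ≈, a trivial weight is φ ∘ w for w the empty product of weights and φ the constant ε.
  coclone-∋-trivial : ∀ {E : WgtClass B} → IsWeightCoclone B E → ∀ w → Trivial B w → E w
  coclone-∋-trivial E-coclone w triv =
    extensional (arity w) M (λ _ → ε) (fun w) (λ x → ≈.sym (triv x))
      (hom (weight (arity w) (ΠPom ⊥ ⊥-elim) (λ _ ())) M to-ε
        (product (arity w) ⊥ ⊥-elim (λ ()) (λ ())))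
    where
      open IsWeightCoclone E-coclone
      M : Pomonoid ℓ
      M = codom w
      open Pomonoid M using (ε)
      open PomonoidProperties M using (module ≈; ≤-refl; identityˡ)
      to-ε : MonoHom (ΠPom ⊥ ⊥-elim) M
      to-ε = record
        { ⟦_⟧ = λ _ → ε ; ⟦⟧-cong = λ _ → ≈.refl ; ⟦⟧-ε = ≈.refl
        ; ⟦⟧-∙ = λ _ _ → ≈.sym (identityˡ ε) ; ⟦⟧-mono = λ _ → ≤-refl }

  generatedByPositive⇔ : ∀ {D : WgtClass B} → IsWeightCoclone B D →
    Σ (WgtClass B) (λ S → (∀ w → S w → 0 < arity w) × IsGeneratedCoclone B S D)
      ⇔ (∀ (w : Weight B) → D w → TrivialOrPositive w)
  generatedByPositive⇔ {D} D-coclone = mk⇔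
    (λ { (S , S-pos , gen) w Dw → lower (IsGeneratedCoclone.least gen _ TrivialOrPositive-isWeightCoclone
                                           (λ w Sw → lift (inj₂ (S-pos w Sw))) w Dw) })
    (λ D-tp → S , (λ w → lower ∘ proj₂) ,
              record { isCoclone = D-coclone
                     ; incl      = λ w → proj₁
                     ; least     = λ E E-coclone S⊆E w Dw → S-generates E E-coclone S⊆E Dw (D-tp w Dw) })
    where
      S : WgtClass B
      S w = D w × Lift (lsuc ℓ) (0 < arity w)
      S-generates : ∀ E → IsWeightCoclone B E → (∀ w → S w → E w) → ∀ {w} → D w → TrivialOrPositive w → E w
      S-generates E E-coclone S⊆E Dw (inj₁ triv) = coclone-∋-trivial E-coclone _ triv
      S-generates E E-coclone S⊆E Dw (inj₂ k>0)  = S⊆E _ (Dw , lift k>0)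

  emptyPmf-preserves : ∀ {n m} (w : Weight B) → TrivialOrPositive w → Preserves B (emptyPmf B n m) w
  emptyPmf-preserves w (inj₁ triv) a b _ =
    ≲-respˡ-≈ (≈.sym (prod-map-ε triv (transpose a))) (≲-respʳ-≈ (≈.sym (prod-map-ε triv (transpose b))) ≤-refl)
    where open PomonoidProperties (codom w)
  emptyPmf-preserves w (inj₂ k>0) a b ∅-ab = ⊥-elim (∅-ab (fromℕ< k>0))

  -- For a nullary weight the two empty pmf give ε ≤ w() ∙ ε and w() ∙ ε ≤ ε.
  preserved-by-emptyPmf⇒TrivialOrPositive : ∀ (w : Weight B) →
    Preserves B (emptyPmf B 0 1) w → Preserves B (emptyPmf B 1 0) w → TrivialOrPositive w
  preserved-by-emptyPmf⇒TrivialOrPositive (weight (suc k) M g) _ _ = inj₂ (s≤s z≤n)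
  preserved-by-emptyPmf⇒TrivialOrPositive (weight zero M g) ∅₀₁-pres ∅₁₀-pres =
    inj₁ λ { [] → ≈.trans (≈.sym (identityʳ (g []))) (antisym (∅₁₀-pres [] [] λ ()) (∅₀₁-pres [] [] λ ())) }
    where open PomonoidProperties M

proposition5p5 : ∀ {ℓ : Level} (B : Set ℓ) (C : PmfSet B) (D : WgtClass B) →
    (∀ n m (f : Pmf B n m) → C n m f ⇔ Pol B D n m f) →
    (∀ (w : Weight B) → D w ⇔ Inv B C w) →
    (∀ (s : Shape) →
      ((Σ (PmfSet B) (λ S → (∀ n m f → S n m f → RightShape s n m) × IsGeneratedClone B S C))
        ⇔ (∀ n m (f : Pmf B n m) → C n m f → RightShape s n m ⊎ (n ≡ 0 × m ≡ 0)))
      × ((∀ n m (f : Pmf B n m) → C n m f → RightShape s n m ⊎ (n ≡ 0 × m ≡ 0))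
        ⇔ D (cst₀ B s)))
    ×
    (((Σ (WgtClass B) (λ S → (∀ w → S w → 0 < arity w) × IsGeneratedCoclone B S D))
        ⇔ (∀ (w : Weight B) → D w → Trivial B w ⊎ 0 < arity w))
      × ((∀ (w : Weight B) → D w → Trivial B w ⊎ 0 < arity w)
        ⇔ (C 0 1 (emptyPmf B 0 1) × C 1 0 (emptyPmf B 1 0))))
proposition5p5 B C D C⇔Pol D⇔Inv =
  (λ s → generatedByRightShape⇔ s C-isClone ,
         mk⇔ (λ C-rs → from (D⇔Inv _) (λ n m f Cf → from (preserves-cst₀⇔ s f) (C-rs n m f Cf)))
             (λ D∋cst₀ n m f Cf → to (preserves-cst₀⇔ s f) (to (D⇔Inv _) D∋cst₀ n m f Cf))) ,
  generatedByPositive⇔ D-isCoclone ,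
  mk⇔ (λ D-tp → from (C⇔Pol 0 1 _) (λ w Dw → emptyPmf-preserves w (D-tp w Dw)) ,
                from (C⇔Pol 1 0 _) (λ w Dw → emptyPmf-preserves w (D-tp w Dw)))
      (λ { (C∋∅₀₁ , C∋∅₁₀) w Dw → preserved-by-emptyPmf⇒TrivialOrPositive w
             (to (D⇔Inv w) Dw 0 1 _ C∋∅₀₁) (to (D⇔Inv w) Dw 1 0 _ C∋∅₁₀) })
  where
    C-isClone : IsPmfClone B C
    C-isClone = IsPmfClone-resp-⇔ C⇔Pol (Pol-isPmfClone D)
    D-isCoclone : IsWeightCoclone B D
    D-isCoclone = IsWeightCoclone-resp-⇔ D⇔Inv (Inv-isWeightCoclone C)
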